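{- Let $(B_1,B_2)$ be a B-ESG rewrite pattern and let $S\Rightarrow^{G_1}_{v_1,p_1}H_1\Rightarrow^{G_1}_{v_2,p_2}\cdots\Rightarrow^{G_1}_{v_n,p_n}H_n\Rightarrow^T_*F$ and $S\Rightarrow^{G_2}_{v_1,p_1}H'_1\Rightarrow^{G_2}_{v_2,p_2}\cdots\Rightarrow^{G_2}_{v_n,p_n}H'_n\Rightarrow^T_*F'$ be a B-ESG pattern instantiation. Then $F$ and $F'$ are string graphs with the same set of inputs and the same set of outputs; that is, the instantiation is a string graph rewrite rule $F\leftarrow I\rightarrow F'$ with $I$ the common boundary.
   Context: Graphs: a graph over $\Sigma,\Gamma$ is $H=(V,E,\lambda)$ with $V$ finite, $E\subseteq\{(v,\gamma,w): v\neq w,\gamma\in\Gamma\}$, $\lambda:V\to\Sigma$. A graph with embedding is $(D,C)$ with $C\subseteq\Sigma\times\Gamma\times\Gamma\times V_D\times\{in,out\}$, elements written $(\sigma,\beta/\gamma,x,d)$. An edNCE grammar $G=(\Sigma,\Delta,\Gamma,\Omega,P,S)$ has terminal labels $\Delta$, final edge labels $\Omega$, finitely many productions $X\to(D,C)$ ($X$ non-terminal) and initial non-terminal $S$. Applying $X\to(D,C)$ to an $X$-labelled vertex $v$: delete $v$, add a copy of $D$, and for every $\beta$-edge between $v$ and a $\sigma$-labelled vertex $w$ directed into $v$ ($d=in$) or out of $v$ ($d=out$) and each $(\sigma,\beta/\gamma,x,d)\in C$, add a $\gamma$-edge between $w$ and $x$ ($w\to x$ if $d=in$, $x\to w$ if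 $d=out$). $H\Rightarrow_{v,p}H'$ denotes applying production $p$ at vertex $v$. Derivations start from a single $S$-labelled vertex. B-edNCE: production bodies have no adjacent non-terminals and no instruction has non-terminal $\sigma$. String graphs: for disjoint label sets $\mathcal N$ (node-vertices), $\mathcal W$ (wire-vertices), a string graph is a directed graph labelled in $\mathcal N\cup\mathcal W$ with no edge between node-vertices and all wire-vertices of in- and out-degree at most one. Inputs/outputs: wire-vertices with no incoming/outgoing edges; the boundary is the set of inputs and outputs. A string graph rewrite rule is a span $L\leftarrow I\rightarrow R$ of string graphs where $I$ is the common boundary of $L$ and $R$. Encoded string graph: a string graph where edges labelled by encoding symbols $\alpha\in\mathcal E$ ($\mathcal E$ finite) may additionally join node-vertices. Decoding system $T$: for each $(\alpha,N_1,N_2)\in\mathcal E\times\mathcal N\times\mathcal N$ one DPO rule replacing a single $\alpha$-edge from an $N_1$ node-vertex to an $N_2$ node-vertex (interface: the two node-vertices) by a connected string graph with no inputs, outputs or encoding labels; decoding means rewriting with $T$ until no encoding edge remains. B-ESG grammar $B=(G,T)$: $T$ a decoding system, $G=(\Sigma,\Delta,\Gamma,\Gamma,P,S)$ B-edNCE with $\Delta=\mathcal N\cup\mathcal W$, $\mathcal E\subseteq\Gamma$, and for each production $X\to(D,C)$: (N1) an edge of $D$ has encoding label iff it joins two node-vertices; (N2) instructions $(N,\alpha/\beta,x,d)$ with $N\in\mathcal N$, $x$ a node-vertex have $\beta\in\mathcal E$; (W1) wire-vertices of $D$ have in- and out-degree at most one; (W2) no instruction $(\sigma,\alpha/\beta,x,d)$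 has $x$ a wire-vertex; (W3) for each $W\in\mathcal W,\gamma,d$ at most one instruction $(W,\gamma/\delta,x,d)$, and $\delta\notin\mathcal E$; (W4) if a non-terminal $y$ with label $Y$ in $D$ is adjacent to a $W$-labelled wire-vertex via an edge of direction $d$ and label $\beta$, or there is an instruction $(W,\alpha/\beta,y,d)$, then all productions for $Y$ contain an instruction $(W,\beta/\gamma,z,d)$. B-ESG rewrite pattern: a pair of B-ESG grammars $B_1=(G_1,T)$, $B_2=(G_2,T)$ with $G_i=(\Sigma,\Delta,\Gamma,\Gamma,P_i,S)$ (same alphabets, same decoding system, same initial non-terminal), together with a bijective correspondence between $P_1$ and $P_2$ pairing productions $X\to(D_1,C_1)$ and $X\to(D_2,C_2)$ with the same left-hand side, such that for each corresponding pair: (NT) there is a label-preserving bijection between the non-terminal vertices of $D_1$ and those of $D_2$; (IO) there is a bijection between the inputs (resp. outputs) of $D_1$ and the inputs (resp. outputs) of $D_2$. Corresponding inputs/outputs/non-terminals are identified (given the same names). A B-ESG pattern instantiation of $(B_1,B_2)$ is a pair of concrete derivations using the identical sequence of (vertex, production) pairs $(v_i,p_i)$ in $G_1$ and $G_2$ (with $p_i$ interpreted via the correspondence and $v_i$ via the identification of corresponding non-terminals), ending in graphs $H_n,H'_n$ without non-terminals, which are then decoded with $T$ to $F$ and $F'$. Vertices of $F$ and $F'$ arising from corresponding (identified) vertices are identified. -}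

module Defs where

open import Data.Nat using (ℕ; _≟_)
open import Data.List using (List; []; _∷_; [_]; map)
open import Data.List.Membership.Propositional using (_∈_; _∉_)
open import Data.Product using (Σ; _×_; _,_; ∃; ∃-syntax)
open import Data.Sum using (_⊎_)
open import Relation.Nullary using (¬_; does)
open import Relation.Binary.PropositionalEquality using (_≡_; _≢_)
open import Relation.Binary.Construct.Closure.ReflexiveTransitive using (Star)
open import Function.Bundles using (_⇔_)
open import Data.Bool using (if_then_else_)

Finite : Set → Set
Finite A = Σ (List A) λ xs → ∀ a → a ∈ xs

-- The alphabets: node labels 𝒩, wire labels 𝒲, non-terminal labels
-- (Σ = 𝒩 ⊎ 𝒲 ⊎ non-terminals, Δ = 𝒩 ⊎ 𝒲), edge labels Γ (= Ω),
-- and the encoding labels ℰ ⊆ Γ given as a predicate.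
record Alphabet : Set₁ where
  field
    NodeL WireL NTL EdgeL : Set
    Enc : EdgeL → Set
    NodeL-finite : Finite NodeL
    WireL-finite : Finite WireL
    NTL-finite : Finite NTL
    EdgeL-finite : Finite EdgeL

module Core (A : Alphabet) where
  open Alphabet A public

  data Lab : Set where
    node : NodeL → Lab
    wire : WireL → Lab
    nt   : NTL → Lab

  IsNode IsWire IsNT IsTerminal : Lab → Set
  IsNode l = ∃[ N ] (l ≡ node N)
  IsWire l = ∃[ W ] (l ≡ wire W)
  IsNT l = ∃[ X ] (l ≡ nt X)
  IsTerminal l = IsNode l ⊎ IsWire l

  -- Graphs over vertex names of type Vt: finite vertex list, finite
  -- edge list (read as sets via membership), labelling function.
  record Graph (Vt : Set) : Set where
    constructor mkGraph
    field
      V   : List Vt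
      E   : List (Vt × EdgeL × Vt)
      lab : Vt → Lab
  open Graph public

  module _ {Vt : Set} (G : Graph Vt) where
    WF : Set
    WF = ∀ a γ b → (a , γ , b) ∈ E G → a ∈ V G × b ∈ V G × a ≢ b

    InDeg≤1 OutDeg≤1 : Vt → Set
    InDeg≤1 u = ∀ a γ a' γ' → (a , γ , u) ∈ E G → (a' , γ' , u) ∈ E G → a ≡ a' × γ ≡ γ'
    OutDeg≤1 u = ∀ b γ b' γ' → (u , γ , b) ∈ E G → (u , γ' , b') ∈ E G → b ≡ b' × γ ≡ γ'

    IsInput IsOutput : Vt → Set
    IsInput u = u ∈ V G × IsWire (lab G u) × (∀ a γ → (a , γ , u) ∉ E G)
    IsOutput u = u ∈ V G × IsWire (lab G u) × (∀ b γ → (u , γ , b) ∉ E G)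

    IsStringGraph : Set
    IsStringGraph =
      WF
      × (∀ u → u ∈ V G → IsTerminal (lab G u))
      × (∀ a γ b → (a , γ , b) ∈ E G → ¬ (IsNode (lab G a) × IsNode (lab G b)))
      × (∀ u → u ∈ V G → IsWire (lab G u) → InDeg≤1 u × OutDeg≤1 u)

    Adj : Vt → Vt → Set
    Adj x y = ∃[ γ ] ((x , γ , y) ∈ E G ⊎ (y , γ , x) ∈ E G)

    Connected : Set
    Connected = ∀ x y → x ∈ V G → y ∈ V G → Star Adj x y

  data Dir : Set where
    inD outD : Dir

  record Instr : Set where
    constructor instr
    field
      σ   : Lab
      β   : EdgeL
      γ   : EdgeL
      tgt : ℕ
      dir : Dir
  open Instr public

  record Body : Set where
    constructor mkBody
    field
      graph : Graph ℕ
      C     : List Instr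
  open Body public

  record Production : Set where
    constructor _⟶_
    field
      lhs  : NTL
      body : Body
  open Production public

  -- vertices of host graphs are named by paths: the copy of body vertex x
  -- created when replacing vertex v is named x ∷ v; the initial vertex is [].
  Name : Set
  Name = List ℕ

  HGraph : Set
  HGraph = Graph Name

  start : NTL → HGraph
  start S = mkGraph [ [] ] [] (λ _ → nt S)

  record Step (H : HGraph) (v : Name) (p : Production) (H' : HGraph) : Set where
    field
      v∈ : v ∈ V H
      v-lab : lab H v ≡ nt (lhs p)
      vertices : ∀ u → (u ∈ V H') ⇔
        ((u ∈ V H × u ≢ v) ⊎ ∃[ x ] (x ∈ V (graph (body p)) × u ≡ x ∷ v))
      old-lab : ∀ u → u ∈ V H → u ≢ v → lab H' u ≡ lab H u
      new-lab : ∀ x → x ∈ V (graph (body p)) → lab H' (x ∷ v) ≡ lab (graph (body p)) x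
      edges : ∀ a c b → ((a , c , b) ∈ E H') ⇔
        (((a , c , b) ∈ E H × a ≢ v × b ≢ v)
        ⊎ (∃[ x ] ∃[ y ] ((x , c , y) ∈ E (graph (body p)) × a ≡ x ∷ v × b ≡ y ∷ v))
        ⊎ (∃[ b₀ ] ∃[ x ] ((a , b₀ , v) ∈ E H
              × instr (lab H a) b₀ c x inD ∈ C (body p) × b ≡ x ∷ v))
        ⊎ (∃[ b₀ ] ∃[ x ] ((v , b₀ , b) ∈ E H
              × instr (lab H b) b₀ c x outD ∈ C (body p) × a ≡ x ∷ v)))

  NoNT : HGraph → Set
  NoNT H = ∀ u → u ∈ V H → ¬ IsNT (lab H u)

  AdjDir : Graph ℕ → ℕ → EdgeL → ℕ → Dir → Set
  AdjDir D w c y inD = (w , c , y) ∈ E D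
  AdjDir D w c y outD = (y , c , w) ∈ E D

  ProdOK : Production → Set
  ProdOK p =
      WF D
    × (∀ i → i ∈ Cs → tgt i ∈ V D)
    × (∀ a c b → (a , c , b) ∈ E D → ¬ (IsNT (lab D a) × IsNT (lab D b)))
    × (∀ i → i ∈ Cs → ¬ IsNT (σ i))
    × (∀ a c b → (a , c , b) ∈ E D → Enc c ⇔ (IsNode (lab D a) × IsNode (lab D b)))
    × (∀ i → i ∈ Cs → IsNode (σ i) → IsNode (lab D (tgt i)) → Enc (γ i))
    × (∀ x → x ∈ V D → IsWire (lab D x) → InDeg≤1 D x × OutDeg≤1 D x)
    × (∀ i → i ∈ Cs → ¬ IsWire (lab D (tgt i)))
    × (∀ i i' → i ∈ Cs → i' ∈ Cs → IsWire (σ i) → σ i ≡ σ i' → β i ≡ β i' → dir i ≡ dir i' → i ≡ i')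
    × (∀ i → i ∈ Cs → IsWire (σ i) → ¬ Enc (γ i))
    where
      D = graph (body p)
      Cs = C (body p)

  W4 : List Production → Set
  W4 Ps = ∀ p → p ∈ Ps → ∀ y Y W c d →
    y ∈ V (graph (body p)) → lab (graph (body p)) y ≡ nt Y →
    ((∃[ w ] (w ∈ V (graph (body p)) × lab (graph (body p)) w ≡ wire W
               × AdjDir (graph (body p)) w c y d))
     ⊎ (∃[ a ] (instr (wire W) a c y d ∈ C (body p)))) →
    ∀ p' → p' ∈ Ps → lhs p' ≡ Y →
      ∃[ c' ] ∃[ z ] (instr (wire W) c c' z d ∈ C (body p'))

  IsBESGProds : List Production → Set
  IsBESGProds Ps = (∀ p → p ∈ Ps → ProdOK p) × W4 Ps

  -- a DPO rule whose left side is a single edge src → tgt (interface: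
  -- the two node-vertices src, tgt) and whose right side is R
  record DecRule : Set where
    constructor mkDecRule
    field
      R   : Graph ℕ
      src : ℕ
      dst : ℕ
  open DecRule public

  DecodingSystem : Set
  DecodingSystem = EdgeL → NodeL → NodeL → DecRule

  ValidDecSys : DecodingSystem → Set
  ValidDecSys T = ∀ α N₁ N₂ → Enc α → let r = T α N₁ N₂ in
      src r ∈ V (R r) × dst r ∈ V (R r) × src r ≢ dst r
    × lab (R r) (src r) ≡ node N₁ × lab (R r) (dst r) ≡ node N₂
    × IsStringGraph (R r) × Connected (R r)
    × (∀ u → ¬ IsInput (R r) u) × (∀ u → ¬ IsOutput (R r) u)
    × (∀ a c b → (a , c , b) ∈ E (R r) → ¬ Enc c)

  Interior : DecRule → ℕ → Set
  Interior r x = x ∈ V (R r) × x ≢ src r × x ≢ dst r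

  glue : DecRule → Name → Name → (ℕ → Name) → ℕ → Name
  glue r a b f x =
    if does (x ≟ src r) then a else (if does (x ≟ dst r) then b else f x)

  record DecStep (T : DecodingSystem) (H H' : HGraph) : Set where
    field
      a b : Name
      α : EdgeL
      N₁ N₂ : NodeL
      enc : Enc α
      edge∈ : (a , α , b) ∈ E H
      a-lab : lab H a ≡ node N₁
      b-lab : lab H b ≡ node N₂
      fresh : ℕ → Name
      fresh-new : ∀ x → Interior (T α N₁ N₂) x → fresh x ∉ V H
      fresh-inj : ∀ x y → Interior (T α N₁ N₂) x → Interior (T α N₁ N₂) y →
                  fresh x ≡ fresh y → x ≡ y
      vertices : ∀ u → (u ∈ V H') ⇔
        (u ∈ V H ⊎ ∃[ x ] (Interior (T α N₁ N₂) x × u ≡ fresh x))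
      old-lab : ∀ u → u ∈ V H → lab H' u ≡ lab H u
      new-lab : ∀ x → Interior (T α N₁ N₂) x → lab H' (fresh x) ≡ lab (R (T α N₁ N₂)) x
      edges : ∀ e → (e ∈ E H') ⇔
        ((e ∈ E H × e ≢ (a , α , b))
        ⊎ ∃[ x ] ∃[ c ] ∃[ y ] ((x , c , y) ∈ E (R (T α N₁ N₂))
            × e ≡ (glue (T α N₁ N₂) a b fresh x , c , glue (T α N₁ N₂) a b fresh y)))

  Decodes : DecodingSystem → HGraph → HGraph → Set
  Decodes T H F = Star (DecStep T) H F × (∀ a c b → (a , c , b) ∈ E F → ¬ Enc c)

  -- rewrite patterns: the bijective correspondence P₁ ≅ P₂ is given by
  -- a list of pairs of corresponding productions with the same lhs;
  -- corresponding inputs/outputs/non-terminals carry the same name.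

  record PProd : Set where
    constructor pprod
    field
      plhs : NTL
      D₁ D₂ : Body
  open PProd public

  side₁ side₂ : PProd → Production
  side₁ q = plhs q ⟶ D₁ q
  side₂ q = plhs q ⟶ D₂ q

  PairOK : PProd → Set
  PairOK q =
      (∀ x Y → (x ∈ V G₁ × lab G₁ x ≡ nt Y) ⇔ (x ∈ V G₂ × lab G₂ x ≡ nt Y))
    × (∀ x → IsInput G₁ x ⇔ IsInput G₂ x)
    × (∀ x → IsOutput G₁ x ⇔ IsOutput G₂ x)
    -- only corresponding vertices share a name
    × (∀ x → x ∈ V G₁ → x ∈ V G₂ →
         (IsNT (lab G₁ x) × IsNT (lab G₂ x))
       ⊎ (IsInput G₁ x × IsInput G₂ x)
       ⊎ (IsOutput G₁ x × IsOutput G₂ x))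
    where
      G₁ = graph (D₁ q)
      G₂ = graph (D₂ q)

  IsPattern : List PProd → Set
  IsPattern Ps = ∀ q → q ∈ Ps → PairOK q

  data Derive (Ps : List PProd) (side : PProd → Production)
       : HGraph → List (Name × PProd) → HGraph → Set where
    done : ∀ {H} → Derive Ps side H [] H
    step : ∀ {H H₁ H₂ v q rest} → q ∈ Ps → Step H v (side q) H₁ →
           Derive Ps side H₁ rest H₂ → Derive Ps side H ((v , q) ∷ rest) H₂

-- The two derivations are followed in lockstep. Every sentential form is
-- loop-free, its node–node edges carry encoding labels, its wire-vertices
-- have in- and out-degree at most one, and every edge between a wire-vertex
-- and a non-terminal is matched by an instruction of each production for that
-- non-terminal (the host-graph form of (W4)). The last property makes a step
-- at v reroute all wires at v, so the boundary after the step is the old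
-- boundary together with the boundary of the inserted body; as corresponding
-- bodies share their inputs and outputs, H_i and H'_i keep a common boundary.
-- Decoding replaces edges between node-vertices by closed string graphs glued
-- at those node-vertices, which changes neither inputs nor outputs and leaves
-- no node–node edge, so F and F' are string graphs.

module Submission where

open import Defs
open import Data.Nat using (ℕ; _<_; _≟_)
open import Data.Nat.Properties using (<-irrefl; n<1+n; m<n⇒m<1+n)
open import Data.List using (List; _∷_; map; length)
open import Data.List.Properties using (≡-dec; ∷-injectiveˡ)
open import Data.List.Membership.Propositional using (_∈_; _∉_)
open import Data.List.Membership.Propositional.Properties using (∈-map⁺)
open import Data.List.Relation.Unary.Any using (here; there)
open import Data.Product using (_×_; _,_; proj₁; proj₂; ∃-syntax)
open import Data.Sum using (_⊎_; inj₁; inj₂)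
open import Data.Empty using (⊥-elim)
open import Relation.Nullary using (¬_; Dec; yes; no)
open import Relation.Nullary.Decidable using (dec-true; dec-false)
open import Relation.Binary.PropositionalEquality
open import Relation.Binary.Construct.Closure.ReflexiveTransitive using (Star; ε; _◅_)
open import Function using (_∘_)
open import Function.Bundles using (_⇔_; mk⇔; Equivalence)
import Function.Properties.Equivalence as ⇔

open Equivalence using (to; from)

,,-injective : ∀ {X Y Z : Set} {a a' : X} {b b' : Y} {c c' : Z} →
               (a , b , c) ≡ (a' , b' , c') → a ≡ a' × b ≡ b' × c ≡ c'
,,-injective refl = refl , refl , refl

infix 4 _⊏_

-- w ⊏ u : w is a proper suffix of u. Sentential forms are suffix-free, so
-- the names x ∷ v introduced when replacing v are fresh.
data _⊏_ : List ℕ → List ℕ → Set where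
  ⊏-one  : ∀ {w x} → w ⊏ x ∷ w
  ⊏-more : ∀ {w x u} → w ⊏ u → w ⊏ x ∷ u

⊏⇒length< : ∀ {w u} → w ⊏ u → length w < length u
⊏⇒length< {w} ⊏-one = n<1+n (length w)
⊏⇒length< (⊏-more s) = m<n⇒m<1+n (⊏⇒length< s)

∷⊏⇒⊏ : ∀ {w x u} → x ∷ w ⊏ u → w ⊏ u
∷⊏⇒⊏ ⊏-one = ⊏-more ⊏-one
∷⊏⇒⊏ (⊏-more s) = ⊏-more (∷⊏⇒⊏ s)

⊏-∷⁻ : ∀ {w x v} → w ⊏ x ∷ v → w ≡ v ⊎ w ⊏ v
⊏-∷⁻ ⊏-one = inj₁ refl
⊏-∷⁻ (⊏-more s) = inj₂ s

module _ (A : Alphabet) where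
  open Core A

  wire⇒¬node : ∀ {l} → IsWire l → ¬ IsNode l
  wire⇒¬node (_ , refl) (_ , ())

  _≟ᴺ_ : (u w : Name) → Dec (u ≡ w)
  _≟ᴺ_ = ≡-dec _≟_

  SuffixFree : HGraph → Set
  SuffixFree H = ∀ u w → u ∈ V H → w ∈ V H → ¬ w ⊏ u

  NodeEdgesEncoded : HGraph → Set
  NodeEdgesEncoded H =
    ∀ a c b → (a , c , b) ∈ E H → IsNode (lab H a) → IsNode (lab H b) → Enc c

  WireDegrees≤1 : HGraph → Set
  WireDegrees≤1 H = ∀ u → u ∈ V H → IsWire (lab H u) → InDeg≤1 H u × OutDeg≤1 H u

  Adjacent : HGraph → Name → EdgeL → Name → Dir → Set
  Adjacent H w c y inD = (w , c , y) ∈ E H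
  Adjacent H w c y outD = (y , c , w) ∈ E H

  WiresRerouted : List Production → HGraph → Set
  WiresRerouted Ps H = ∀ w W c y Y d → lab H w ≡ wire W → lab H y ≡ nt Y →
    Adjacent H w c y d → ∀ p → p ∈ Ps → lhs p ≡ Y →
    ∃[ c' ] ∃[ z ] (instr (wire W) c c' z d ∈ C (body p))

  record SententialInv (Ps : List Production) (H : HGraph) : Set where
    field
      wf : WF H
      suffix-free : SuffixFree H
      node-enc : NodeEdgesEncoded H
      wire-deg : WireDegrees≤1 H
      rerouted : WiresRerouted Ps H

  start-inv : ∀ Ps S → SententialInv Ps (start S)
  start-inv Ps S = record
    { wf = λ _ _ _ ()
    ; suffix-free = λ { _ _ (here refl) (here refl) () ; _ _ (here refl) (there ()) ; _ _ (there ()) _ }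
    ; node-enc = λ _ _ _ ()
    ; wire-deg = λ _ _ _ → (λ _ _ _ _ ()) , (λ _ _ _ _ ())
    ; rerouted = λ { _ _ _ _ _ inD _ _ () ; _ _ _ _ _ outD _ _ () } }

  SameBoundary : HGraph → HGraph → Set
  SameBoundary H H' = (∀ u → IsInput H u ⇔ IsInput H' u) × (∀ u → IsOutput H u ⇔ IsOutput H' u)

  module Conditions {p : Production} (ok : ProdOK p) where
    private
      D = graph (body p)
      Cs = C (body p)
    body-wf : WF D
    body-wf = let (h , _ , _ , _ , _ , _ , _ , _ , _ , _) = ok in h
    tgt∈V : ∀ i → i ∈ Cs → tgt i ∈ V D
    tgt∈V = let (_ , h , _ , _ , _ , _ , _ , _ , _ , _) = ok in h
    N1 : ∀ a c b → (a , c , b) ∈ E D → Enc c ⇔ (IsNode (lab D a) × IsNode (lab D b))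
    N1 = let (_ , _ , _ , _ , h , _ , _ , _ , _ , _) = ok in h
    N2 : ∀ i → i ∈ Cs → IsNode (σ i) → IsNode (lab D (tgt i)) → Enc (γ i)
    N2 = let (_ , _ , _ , _ , _ , h , _ , _ , _ , _) = ok in h
    W1 : ∀ x → x ∈ V D → IsWire (lab D x) → InDeg≤1 D x × OutDeg≤1 D x
    W1 = let (_ , _ , _ , _ , _ , _ , h , _ , _ , _) = ok in h
    W2 : ∀ i → i ∈ Cs → ¬ IsWire (lab D (tgt i))
    W2 = let (_ , _ , _ , _ , _ , _ , _ , h , _ , _) = ok in h
    W3 : ∀ i i' → i ∈ Cs → i' ∈ Cs → IsWire (σ i) → σ i ≡ σ i' → β i ≡ β i' →
         dir i ≡ dir i' → i ≡ i'
    W3 = let (_ , _ , _ , _ , _ , _ , _ , _ , h , _) = ok in h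

  module ProductionStep {Ps : List Production} (besg : IsBESGProds Ps)
      {p : Production} (p∈ : p ∈ Ps)
      {H H₁ : HGraph} {v : Name} (st : Step H v p H₁) (inv : SententialInv Ps H) where
    private
      D = graph (body p)
      Cs = C (body p)
      module S = Step st
    open SententialInv inv
    open Conditions {p} (proj₁ besg p p∈)

    old∈ : ∀ {u} → u ∈ V H → u ≢ v → u ∈ V H₁
    old∈ u∈ u≢ = from (S.vertices _) (inj₁ (u∈ , u≢))

    new∈ : ∀ {x} → x ∈ V D → x ∷ v ∈ V H₁
    new∈ {x} x∈ = from (S.vertices _) (inj₂ (x , x∈ , refl))

    new∉old : ∀ {x} → x ∷ v ∉ V H
    new∉old {x} x∷v∈ = suffix-free (x ∷ v) v x∷v∈ S.v∈ ⊏-one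

    new∈⇒body∈ : ∀ {x} → x ∷ v ∈ V H₁ → x ∈ V D
    new∈⇒body∈ {x} m with to (S.vertices (x ∷ v)) m
    ... | inj₁ (m₀ , _) = ⊥-elim (new∉old m₀)
    ... | inj₂ (x' , x'∈ , eq) = subst (_∈ V D) (sym (∷-injectiveˡ eq)) x'∈

    lab-old : ∀ {u} → u ∈ V H → u ≢ v → lab H₁ u ≡ lab H u
    lab-old u∈ u≢ = S.old-lab _ u∈ u≢

    lab-new : ∀ {x} → x ∈ V D → lab H₁ (x ∷ v) ≡ lab D x
    lab-new x∈ = S.new-lab _ x∈

    wf′ : WF H₁
    wf′ a c b e with to (S.edges a c b) e
    ... | inj₁ (e₀ , a≢ , b≢) =
      let (a∈ , b∈ , a≢b) = wf a c b e₀ in old∈ a∈ a≢ , old∈ b∈ b≢ , a≢b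
    ... | inj₂ (inj₁ (x , y , e₀ , refl , refl)) =
      let (x∈ , y∈ , x≢y) = body-wf x c y e₀ in new∈ x∈ , new∈ y∈ , λ eq → x≢y (∷-injectiveˡ eq)
    ... | inj₂ (inj₂ (inj₁ (_ , _ , e₀ , i∈ , refl))) =
      let (a∈ , _ , a≢) = wf _ _ v e₀ in
      old∈ a∈ a≢ , new∈ (tgt∈V _ i∈) , λ eq → new∉old (subst (_∈ V H) eq a∈)
    ... | inj₂ (inj₂ (inj₂ (_ , _ , e₀ , i∈ , refl))) =
      let (_ , b∈ , v≢b) = wf v _ _ e₀ in
      new∈ (tgt∈V _ i∈) , old∈ b∈ (v≢b ∘ sym) , λ eq → new∉old (subst (_∈ V H) (sym eq) b∈)

    node-enc′ : NodeEdgesEncoded H₁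
    node-enc′ a c b e na nb with to (S.edges a c b) e
    ... | inj₁ (e₀ , a≢ , b≢) = let (a∈ , b∈ , _) = wf a c b e₀ in
      node-enc a c b e₀ (subst IsNode (lab-old a∈ a≢) na) (subst IsNode (lab-old b∈ b≢) nb)
    ... | inj₂ (inj₁ (x , y , e₀ , refl , refl)) = let (x∈ , y∈ , _) = body-wf x c y e₀ in
      from (N1 x c y e₀) (subst IsNode (lab-new x∈) na , subst IsNode (lab-new y∈) nb)
    ... | inj₂ (inj₂ (inj₁ (_ , _ , e₀ , i∈ , refl))) = let (a∈ , _ , a≢) = wf a _ v e₀ in
      N2 _ i∈ (subst IsNode (lab-old a∈ a≢) na) (subst IsNode (lab-new (tgt∈V _ i∈)) nb)
    ... | inj₂ (inj₂ (inj₂ (_ , _ , e₀ , i∈ , refl))) = let (_ , b∈ , v≢b) = wf v _ b e₀ in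
      N2 _ i∈ (subst IsNode (lab-old b∈ (v≢b ∘ sym)) nb) (subst IsNode (lab-new (tgt∈V _ i∈)) na)

    IncomingOld : Name → EdgeL → Name → Set
    IncomingOld a c u = ((a , c , u) ∈ E H × a ≢ v)
      ⊎ ∃[ b₀ ] ∃[ x ] ((v , b₀ , u) ∈ E H × instr (lab H u) b₀ c x outD ∈ Cs × a ≡ x ∷ v)

    incoming-old : ∀ {u} → u ∈ V H → ∀ a c → (a , c , u) ∈ E H₁ → IncomingOld a c u
    incoming-old {u} u∈ a c e with to (S.edges a c u) e
    ... | inj₁ (e₀ , a≢ , _) = inj₁ (e₀ , a≢)
    ... | inj₂ (inj₁ (_ , _ , _ , _ , eq)) = ⊥-elim (new∉old (subst (_∈ V H) eq u∈))
    ... | inj₂ (inj₂ (inj₁ (_ , _ , _ , _ , eq))) = ⊥-elim (new∉old (subst (_∈ V H) eq u∈))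
    ... | inj₂ (inj₂ (inj₂ edge)) = inj₂ edge

    OutgoingOld : Name → EdgeL → Name → Set
    OutgoingOld u c b = ((u , c , b) ∈ E H × b ≢ v)
      ⊎ ∃[ b₀ ] ∃[ x ] ((u , b₀ , v) ∈ E H × instr (lab H u) b₀ c x inD ∈ Cs × b ≡ x ∷ v)

    outgoing-old : ∀ {u} → u ∈ V H → ∀ b c → (u , c , b) ∈ E H₁ → OutgoingOld u c b
    outgoing-old {u} u∈ b c e with to (S.edges u c b) e
    ... | inj₁ (e₀ , _ , b≢) = inj₁ (e₀ , b≢)
    ... | inj₂ (inj₁ (_ , _ , _ , eq , _)) = ⊥-elim (new∉old (subst (_∈ V H) eq u∈))
    ... | inj₂ (inj₂ (inj₁ edge)) = inj₂ edge
    ... | inj₂ (inj₂ (inj₂ (_ , _ , _ , _ , eq))) = ⊥-elim (new∉old (subst (_∈ V H) eq u∈))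

    incoming-new : ∀ {x} → IsWire (lab D x) → ∀ a c → (a , c , x ∷ v) ∈ E H₁ →
                   ∃[ x₀ ] ((x₀ , c , x) ∈ E D × a ≡ x₀ ∷ v)
    incoming-new {x} w a c e with to (S.edges a c (x ∷ v)) e
    ... | inj₁ (e₀ , _ , _) = ⊥-elim (new∉old (proj₁ (proj₂ (wf a c _ e₀))))
    ... | inj₂ (inj₁ (x₀ , _ , e₀ , eqa , eqb)) =
      x₀ , subst (λ z → (x₀ , c , z) ∈ E D) (sym (∷-injectiveˡ eqb)) e₀ , eqa
    ... | inj₂ (inj₂ (inj₁ (_ , _ , _ , i∈ , eqb))) =
      ⊥-elim (W2 _ i∈ (subst (λ z → IsWire (lab D z)) (∷-injectiveˡ eqb) w))
    ... | inj₂ (inj₂ (inj₂ (_ , _ , e₀ , _ , _))) = ⊥-elim (new∉old (proj₁ (proj₂ (wf v _ _ e₀))))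

    outgoing-new : ∀ {x} → IsWire (lab D x) → ∀ b c → (x ∷ v , c , b) ∈ E H₁ →
                   ∃[ y ] ((x , c , y) ∈ E D × b ≡ y ∷ v)
    outgoing-new {x} w b c e with to (S.edges (x ∷ v) c b) e
    ... | inj₁ (e₀ , _ , _) = ⊥-elim (new∉old (proj₁ (wf _ c b e₀)))
    ... | inj₂ (inj₁ (_ , y , e₀ , eqa , eqb)) =
      y , subst (λ z → (z , c , y) ∈ E D) (sym (∷-injectiveˡ eqa)) e₀ , eqb
    ... | inj₂ (inj₂ (inj₁ (_ , _ , e₀ , _ , _))) = ⊥-elim (new∉old (proj₁ (wf _ _ v e₀)))
    ... | inj₂ (inj₂ (inj₂ (_ , _ , _ , i∈ , eqa))) =
      ⊥-elim (W2 _ i∈ (subst (λ z → IsWire (lab D z)) (∷-injectiveˡ eqa) w))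

    -- Two rerouted edges at an old wire-vertex u stem from the unique edge
    -- between u and v, hence by (W3) from one and the same instruction.
    wire-deg-old : ∀ {u} → u ∈ V H → u ≢ v → IsWire (lab H u) → InDeg≤1 H₁ u × OutDeg≤1 H₁ u
    wire-deg-old {u} u∈ u≢ wu = indeg , outdeg
      where
        degs = wire-deg u u∈ wu
        indeg : InDeg≤1 H₁ u
        indeg a c a' c' e e' with incoming-old u∈ a c e | incoming-old u∈ a' c' e'
        ... | inj₁ (e₀ , _) | inj₁ (e₀' , _) = proj₁ degs a c a' c' e₀ e₀'
        ... | inj₁ (e₀ , a≢) | inj₂ (_ , _ , e₀' , _ , _) =
          ⊥-elim (a≢ (proj₁ (proj₁ degs _ _ _ _ e₀ e₀')))
        ... | inj₂ (_ , _ , e₀ , _ , _) | inj₁ (e₀' , a≢) =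
          ⊥-elim (a≢ (proj₁ (proj₁ degs _ _ _ _ e₀' e₀)))
        ... | inj₂ (_ , _ , e₀ , i∈ , refl) | inj₂ (_ , _ , e₀' , i∈' , refl) =
          let same = W3 _ _ i∈ i∈' wu refl (proj₂ (proj₁ degs _ _ _ _ e₀ e₀')) refl
          in cong (λ i → tgt i ∷ v) same , cong γ same
        outdeg : OutDeg≤1 H₁ u
        outdeg b c b' c' e e' with outgoing-old u∈ b c e | outgoing-old u∈ b' c' e'
        ... | inj₁ (e₀ , _) | inj₁ (e₀' , _) = proj₂ degs b c b' c' e₀ e₀'
        ... | inj₁ (e₀ , b≢) | inj₂ (_ , _ , e₀' , _ , _) =
          ⊥-elim (b≢ (proj₁ (proj₂ degs _ _ _ _ e₀ e₀')))
        ... | inj₂ (_ , _ , e₀ , _ , _) | inj₁ (e₀' , b≢) =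
          ⊥-elim (b≢ (proj₁ (proj₂ degs _ _ _ _ e₀' e₀)))
        ... | inj₂ (_ , _ , e₀ , i∈ , refl) | inj₂ (_ , _ , e₀' , i∈' , refl) =
          let same = W3 _ _ i∈ i∈' wu refl (proj₂ (proj₂ degs _ _ _ _ e₀ e₀')) refl
          in cong (λ i → tgt i ∷ v) same , cong γ same

    wire-deg-new : ∀ {x} → x ∈ V D → IsWire (lab D x) → InDeg≤1 H₁ (x ∷ v) × OutDeg≤1 H₁ (x ∷ v)
    wire-deg-new {x} x∈ wx = indeg , outdeg
      where
        degs = W1 x x∈ wx
        indeg : InDeg≤1 H₁ (x ∷ v)
        indeg a c a' c' e e' with incoming-new wx a c e | incoming-new wx a' c' e'
        ... | (x₀ , e₀ , refl) | (x₀' , e₀' , refl) =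
          let (same , c≡c') = proj₁ degs x₀ c x₀' c' e₀ e₀' in cong (_∷ v) same , c≡c'
        outdeg : OutDeg≤1 H₁ (x ∷ v)
        outdeg b c b' c' e e' with outgoing-new wx b c e | outgoing-new wx b' c' e'
        ... | (y , e₀ , refl) | (y' , e₀' , refl) =
          let (same , c≡c') = proj₂ degs y c y' c' e₀ e₀' in cong (_∷ v) same , c≡c'

    wire-deg′ : WireDegrees≤1 H₁
    wire-deg′ u u∈₁ wu with to (S.vertices u) u∈₁
    ... | inj₁ (u∈ , u≢) = wire-deg-old u∈ u≢ (subst IsWire (lab-old u∈ u≢) wu)
    ... | inj₂ (x , x∈ , refl) = wire-deg-new x∈ (subst IsWire (lab-new x∈) wu)

    rerouted′ : WiresRerouted Ps H₁
    rerouted′ w W c y Y inD lw ly e p' p'∈ lp' with to (S.edges w c y) e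
    ... | inj₁ (e₀ , w≢ , y≢) = let (w∈ , y∈ , _) = wf w c y e₀ in
      rerouted w W c y Y inD (trans (sym (lab-old w∈ w≢)) lw) (trans (sym (lab-old y∈ y≢)) ly)
        e₀ p' p'∈ lp'
    ... | inj₂ (inj₁ (x , x' , e₀ , refl , refl)) = let (x∈ , x'∈ , _) = body-wf x c x' e₀ in
      proj₂ besg p p∈ x' Y W c inD x'∈ (trans (sym (lab-new x'∈)) ly)
        (inj₁ (x , x∈ , trans (sym (lab-new x∈)) lw , e₀)) p' p'∈ lp'
    ... | inj₂ (inj₂ (inj₁ (b₀ , x , e₀ , i∈ , refl))) = let (w∈ , _ , w≢) = wf w b₀ v e₀ in
      proj₂ besg p p∈ x Y W c inD (tgt∈V _ i∈) (trans (sym (lab-new (tgt∈V _ i∈))) ly)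
        (inj₂ (b₀ , subst (λ l → instr l b₀ c x inD ∈ Cs) (trans (sym (lab-old w∈ w≢)) lw) i∈))
        p' p'∈ lp'
    ... | inj₂ (inj₂ (inj₂ (_ , _ , _ , i∈ , refl))) =
      ⊥-elim (W2 _ i∈ (W , trans (sym (lab-new (tgt∈V _ i∈))) lw))
    rerouted′ w W c y Y outD lw ly e p' p'∈ lp' with to (S.edges y c w) e
    ... | inj₁ (e₀ , y≢ , w≢) = let (y∈ , w∈ , _) = wf y c w e₀ in
      rerouted w W c y Y outD (trans (sym (lab-old w∈ w≢)) lw) (trans (sym (lab-old y∈ y≢)) ly)
        e₀ p' p'∈ lp'
    ... | inj₂ (inj₁ (x , x' , e₀ , refl , refl)) = let (x∈ , x'∈ , _) = body-wf x c x' e₀ in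
      proj₂ besg p p∈ x Y W c outD x∈ (trans (sym (lab-new x∈)) ly)
        (inj₁ (x' , x'∈ , trans (sym (lab-new x'∈)) lw , e₀)) p' p'∈ lp'
    ... | inj₂ (inj₂ (inj₁ (_ , _ , _ , i∈ , refl))) =
      ⊥-elim (W2 _ i∈ (W , trans (sym (lab-new (tgt∈V _ i∈))) lw))
    ... | inj₂ (inj₂ (inj₂ (b₀ , x , e₀ , i∈ , refl))) = let (_ , w∈ , v≢w) = wf v b₀ w e₀ in
      proj₂ besg p p∈ x Y W c outD (tgt∈V _ i∈) (trans (sym (lab-new (tgt∈V _ i∈))) ly)
        (inj₂ (b₀ , subst (λ l → instr l b₀ c x outD ∈ Cs)
                          (trans (sym (lab-old w∈ (v≢w ∘ sym))) lw) i∈))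
        p' p'∈ lp'

    suffix-free′ : SuffixFree H₁
    suffix-free′ u w u∈ w∈ s with to (S.vertices u) u∈ | to (S.vertices w) w∈
    ... | inj₁ (u∈₀ , _) | inj₁ (w∈₀ , _) = suffix-free u w u∈₀ w∈₀ s
    ... | inj₁ (u∈₀ , _) | inj₂ (_ , _ , refl) = suffix-free u v u∈₀ S.v∈ (∷⊏⇒⊏ s)
    ... | inj₂ (_ , _ , refl) | inj₂ (_ , _ , refl) = <-irrefl refl (⊏⇒length< s)
    ... | inj₂ (_ , _ , refl) | inj₁ (w∈₀ , w≢) with ⊏-∷⁻ s
    ...   | inj₁ w≡v = w≢ w≡v
    ...   | inj₂ s' = suffix-free v w S.v∈ w∈₀ s'

    inv′ : SententialInv Ps H₁
    inv′ = record
      { wf = wf′ ; suffix-free = suffix-free′ ; node-enc = node-enc′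
      ; wire-deg = wire-deg′ ; rerouted = rerouted′ }

    isInput-old⁺ : ∀ {u} → u ≢ v → IsInput H u → IsInput H₁ u
    isInput-old⁺ {u} u≢ (u∈ , wu , no-in) =
      old∈ u∈ u≢ , subst IsWire (sym (lab-old u∈ u≢)) wu , no-in′
      where
        no-in′ : ∀ a c → (a , c , u) ∉ E H₁
        no-in′ a c e with incoming-old u∈ a c e
        ... | inj₁ (e₀ , _) = no-in a c e₀
        ... | inj₂ (b₀ , _ , e₀ , _ , _) = no-in v b₀ e₀

    isOutput-old⁺ : ∀ {u} → u ≢ v → IsOutput H u → IsOutput H₁ u
    isOutput-old⁺ {u} u≢ (u∈ , wu , no-out) =
      old∈ u∈ u≢ , subst IsWire (sym (lab-old u∈ u≢)) wu , no-out′
      where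
        no-out′ : ∀ b c → (u , c , b) ∉ E H₁
        no-out′ b c e with outgoing-old u∈ b c e
        ... | inj₁ (e₀ , _) = no-out b c e₀
        ... | inj₂ (b₀ , _ , e₀ , _ , _) = no-out v b₀ e₀

    isInput-old⁻ : ∀ {u} → u ∈ V H → u ≢ v → IsInput H₁ u → IsInput H u
    isInput-old⁻ {u} u∈ u≢ (_ , wu , no-in) = u∈ , wu₀ , no-in′
      where
        wu₀ = subst IsWire (lab-old u∈ u≢) wu
        no-in′ : ∀ a c → (a , c , u) ∉ E H
        no-in′ a c e with a ≟ᴺ v | wu₀
        ... | no a≢ | _ = no-in a c (from (S.edges a c u) (inj₁ (e , a≢ , u≢)))
        ... | yes refl | (W , lw) with rerouted u W c v (lhs p) outD lw S.v-lab e p p∈ refl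
        ...   | (c' , z , i∈) = no-in (z ∷ v) c' (from (S.edges (z ∷ v) c' u)
                 (inj₂ (inj₂ (inj₂ (c , z , e ,
                   subst (λ l → instr l c c' z outD ∈ Cs) (sym lw) i∈ , refl)))))

    isOutput-old⁻ : ∀ {u} → u ∈ V H → u ≢ v → IsOutput H₁ u → IsOutput H u
    isOutput-old⁻ {u} u∈ u≢ (_ , wu , no-out) = u∈ , wu₀ , no-out′
      where
        wu₀ = subst IsWire (lab-old u∈ u≢) wu
        no-out′ : ∀ b c → (u , c , b) ∉ E H
        no-out′ b c e with b ≟ᴺ v | wu₀
        ... | no b≢ | _ = no-out b c (from (S.edges u c b) (inj₁ (e , u≢ , b≢)))
        ... | yes refl | (W , lw) with rerouted u W c v (lhs p) inD lw S.v-lab e p p∈ refl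
        ...   | (c' , z , i∈) = no-out (z ∷ v) c' (from (S.edges u c' (z ∷ v))
                 (inj₂ (inj₂ (inj₁ (c , z , e ,
                   subst (λ l → instr l c c' z inD ∈ Cs) (sym lw) i∈ , refl)))))

    isInput-new⁺ : ∀ {x} → IsInput D x → IsInput H₁ (x ∷ v)
    isInput-new⁺ (x∈ , wx , no-in) = new∈ x∈ , subst IsWire (sym (lab-new x∈)) wx ,
      λ a c e → let (x₀ , e₀ , _) = incoming-new wx a c e in no-in x₀ c e₀

    isOutput-new⁺ : ∀ {x} → IsOutput D x → IsOutput H₁ (x ∷ v)
    isOutput-new⁺ (x∈ , wx , no-out) = new∈ x∈ , subst IsWire (sym (lab-new x∈)) wx ,
      λ b c e → let (y , e₀ , _) = outgoing-new wx b c e in no-out y c e₀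

    isInput-new⁻ : ∀ {x} → IsInput H₁ (x ∷ v) → IsInput D x
    isInput-new⁻ {x} (m , wu , no-in) = x∈ , subst IsWire (lab-new x∈) wu ,
        λ a c e → no-in (a ∷ v) c (from (S.edges _ _ _) (inj₂ (inj₁ (a , x , e , refl , refl))))
      where x∈ = new∈⇒body∈ m

    isOutput-new⁻ : ∀ {x} → IsOutput H₁ (x ∷ v) → IsOutput D x
    isOutput-new⁻ {x} (m , wu , no-out) = x∈ , subst IsWire (lab-new x∈) wu ,
        λ b c e → no-out (b ∷ v) c (from (S.edges _ _ _) (inj₂ (inj₁ (x , b , e , refl , refl))))
      where x∈ = new∈⇒body∈ m

  module CorrespondingSteps {Ps Ps' : List Production} {p p' : Production}
      {H H' H₁ H₁' : HGraph} {v : Name}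
      (besg : IsBESGProds Ps) (besg' : IsBESGProds Ps') (p∈ : p ∈ Ps) (p'∈ : p' ∈ Ps')
      (st : Step H v p H₁) (st' : Step H' v p' H₁')
      (inv : SententialInv Ps H) (inv' : SententialInv Ps' H') where
    private
      module L = ProductionStep besg p∈ st inv
      module L' = ProductionStep besg' p'∈ st' inv'

    inputs⊆ : (∀ u → IsInput H u → IsInput H' u) →
              (∀ x → IsInput (graph (body p)) x → IsInput (graph (body p')) x) →
              ∀ u → IsInput H₁ u → IsInput H₁' u
    inputs⊆ H⊆H' D⊆D' u input with to (Step.vertices st u) (proj₁ input)
    ... | inj₁ (u∈ , u≢) = L'.isInput-old⁺ u≢ (H⊆H' u (L.isInput-old⁻ u∈ u≢ input))
    ... | inj₂ (x , _ , refl) = L'.isInput-new⁺ (D⊆D' x (L.isInput-new⁻ input))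

    outputs⊆ : (∀ u → IsOutput H u → IsOutput H' u) →
               (∀ x → IsOutput (graph (body p)) x → IsOutput (graph (body p')) x) →
               ∀ u → IsOutput H₁ u → IsOutput H₁' u
    outputs⊆ H⊆H' D⊆D' u output with to (Step.vertices st u) (proj₁ output)
    ... | inj₁ (u∈ , u≢) = L'.isOutput-old⁺ u≢ (H⊆H' u (L.isOutput-old⁻ u∈ u≢ output))
    ... | inj₂ (x , _ , refl) = L'.isOutput-new⁺ (D⊆D' x (L.isOutput-new⁻ output))

  derivations-same-boundary : ∀ {Ps H H' seq Hn Hn'} →
    IsBESGProds (map side₁ Ps) → IsBESGProds (map side₂ Ps) → IsPattern Ps →
    Derive Ps side₁ H seq Hn → Derive Ps side₂ H' seq Hn' →
    SententialInv (map side₁ Ps) H → SententialInv (map side₂ Ps) H' → SameBoundary H H' →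
    SententialInv (map side₁ Ps) Hn × SententialInv (map side₂ Ps) Hn' × SameBoundary Hn Hn'
  derivations-same-boundary _ _ _ done done inv₁ inv₂ same = inv₁ , inv₂ , same
  derivations-same-boundary besg₁ besg₂ pat (step q∈ st₁ d₁) (step q∈' st₂ d₂)
                            inv₁ inv₂ (ins , outs) =
    derivations-same-boundary besg₁ besg₂ pat d₁ d₂
      (ProductionStep.inv′ besg₁ p₁∈ st₁ inv₁) (ProductionStep.inv′ besg₂ p₂∈ st₂ inv₂)
      ((λ u → mk⇔ (T.inputs⊆ (to ∘ ins) (to ∘ D-ins) u)
                  (T⁻¹.inputs⊆ (from ∘ ins) (from ∘ D-ins) u)) ,
       (λ u → mk⇔ (T.outputs⊆ (to ∘ outs) (to ∘ D-outs) u)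
                  (T⁻¹.outputs⊆ (from ∘ outs) (from ∘ D-outs) u)))
    where
      p₁∈ = ∈-map⁺ side₁ q∈
      p₂∈ = ∈-map⁺ side₂ q∈'
      D-ins = proj₁ (proj₂ (pat _ q∈))
      D-outs = proj₁ (proj₂ (proj₂ (pat _ q∈)))
      module T = CorrespondingSteps besg₁ besg₂ p₁∈ p₂∈ st₁ st₂ inv₁ inv₂
      module T⁻¹ = CorrespondingSteps besg₂ besg₁ p₂∈ p₁∈ st₂ st₁ inv₂ inv₁

  record EncodedStringGraph (H : HGraph) : Set where
    field
      wf : WF H
      terminal : ∀ u → u ∈ V H → IsTerminal (lab H u)
      node-enc : NodeEdgesEncoded H
      wire-deg : WireDegrees≤1 H

  sentential⇒encoded : ∀ {Ps H} → SententialInv Ps H → NoNT H → EncodedStringGraph H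
  sentential⇒encoded {H = H} inv no-nt = record
    { wf = wf ; terminal = terminal ; node-enc = node-enc ; wire-deg = wire-deg }
    where
      open SententialInv inv
      terminal : ∀ u → u ∈ V H → IsTerminal (lab H u)
      terminal u u∈ with lab H u in eq
      ... | node N = inj₁ (N , refl)
      ... | wire W = inj₂ (W , refl)
      ... | nt X = ⊥-elim (no-nt u u∈ (X , eq))

  encoded⇒string : ∀ {H} → EncodedStringGraph H → (∀ a c b → (a , c , b) ∈ E H → ¬ Enc c) →
                   IsStringGraph H
  encoded⇒string inv no-enc = wf , terminal ,
      (λ a c b e (na , nb) → no-enc a c b e (node-enc a c b e na nb)) , wire-deg
    where open EncodedStringGraph inv

  module _ (r : DecRule) (a b : Name) (f : ℕ → Name) where

    data GlueView (x : ℕ) : Set where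
      at-src   : x ≡ src r → glue r a b f x ≡ a → GlueView x
      at-dst   : x ≢ src r → x ≡ dst r → glue r a b f x ≡ b → GlueView x
      interior : x ≢ src r → x ≢ dst r → glue r a b f x ≡ f x → GlueView x

    glue-view : ∀ x → GlueView x
    glue-view x with x ≟ src r | x ≟ dst r
    ... | yes x≡s | _ = at-src x≡s glue-src
      where
        glue-src : glue r a b f x ≡ a
        glue-src rewrite dec-true (x ≟ src r) x≡s = refl
    ... | no x≢s | yes x≡d = at-dst x≢s x≡d glue-dst
      where
        glue-dst : glue r a b f x ≡ b
        glue-dst rewrite dec-false (x ≟ src r) x≢s | dec-true (x ≟ dst r) x≡d = refl
    ... | no x≢s | no x≢d = interior x≢s x≢d glue-int
      where
        glue-int : glue r a b f x ≡ f x
        glue-int rewrite dec-false (x ≟ src r) x≢s | dec-false (x ≟ dst r) x≢d = refl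

  module DecodingStep {T : DecodingSystem} (valid : ValidDecSys T) {H H' : HGraph}
                      (ds : DecStep T H H') (inv : EncodedStringGraph H) where
    private
      module Ds = DecStep ds
      r = T Ds.α Ds.N₁ Ds.N₂
      RG = R r
      valid-r = valid Ds.α Ds.N₁ Ds.N₂ Ds.enc
      src-lab : lab RG (src r) ≡ node Ds.N₁
      src-lab = let (_ , _ , _ , h , _ , _ , _ , _ , _ , _) = valid-r in h
      dst-lab : lab RG (dst r) ≡ node Ds.N₂
      dst-lab = let (_ , _ , _ , _ , h , _ , _ , _ , _ , _) = valid-r in h
      R-string : IsStringGraph RG
      R-string = let (_ , _ , _ , _ , _ , h , _ , _ , _ , _) = valid-r in h
      R-no-input : ∀ u → ¬ IsInput RG u
      R-no-input = let (_ , _ , _ , _ , _ , _ , _ , h , _ , _) = valid-r in h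
      R-no-output : ∀ u → ¬ IsOutput RG u
      R-no-output = let (_ , _ , _ , _ , _ , _ , _ , _ , h , _) = valid-r in h
      R-wf : WF RG
      R-wf = let (h , _ , _ , _) = R-string in h
      R-terminal : ∀ u → u ∈ V RG → IsTerminal (lab RG u)
      R-terminal = let (_ , h , _ , _) = R-string in h
      R-no-node-edge : ∀ a c b → (a , c , b) ∈ E RG → ¬ (IsNode (lab RG a) × IsNode (lab RG b))
      R-no-node-edge = let (_ , _ , h , _) = R-string in h
      R-wire-deg : ∀ u → u ∈ V RG → IsWire (lab RG u) → InDeg≤1 RG u × OutDeg≤1 RG u
      R-wire-deg = let (_ , _ , _ , h) = R-string in h
    open EncodedStringGraph inv

    a∈ : Ds.a ∈ V H
    a∈ = proj₁ (wf _ _ _ Ds.edge∈)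
    b∈ : Ds.b ∈ V H
    b∈ = proj₁ (proj₂ (wf _ _ _ Ds.edge∈))
    a≢b : Ds.a ≢ Ds.b
    a≢b = proj₂ (proj₂ (wf _ _ _ Ds.edge∈))

    wire≢a : ∀ {u} → IsWire (lab H u) → u ≢ Ds.a
    wire≢a wu refl = wire⇒¬node wu (Ds.N₁ , Ds.a-lab)

    wire≢b : ∀ {u} → IsWire (lab H u) → u ≢ Ds.b
    wire≢b wu refl = wire⇒¬node wu (Ds.N₂ , Ds.b-lab)

    g : ℕ → Name
    g = glue r Ds.a Ds.b Ds.fresh

    view : ∀ x → GlueView r Ds.a Ds.b Ds.fresh x
    view = glue-view r Ds.a Ds.b Ds.fresh

    old∈ : ∀ {u} → u ∈ V H → u ∈ V H'
    old∈ m = from (Ds.vertices _) (inj₁ m)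

    fresh∉ : ∀ {x} → Interior r x → Ds.fresh x ∉ V H
    fresh∉ ix = Ds.fresh-new _ ix

    g-interior : ∀ {x} → Interior r x → g x ≡ Ds.fresh x
    g-interior {x} (_ , x≢s , x≢d) with view x
    ... | at-src x≡s _ = ⊥-elim (x≢s x≡s)
    ... | at-dst _ x≡d _ = ⊥-elim (x≢d x≡d)
    ... | interior _ _ gx = gx

    g∈ : ∀ {x} → x ∈ V RG → g x ∈ V H'
    g∈ {x} x∈ with view x
    ... | at-src _ gx = subst (_∈ V H') (sym gx) (old∈ a∈)
    ... | at-dst _ _ gx = subst (_∈ V H') (sym gx) (old∈ b∈)
    ... | interior x≢s x≢d gx =
      subst (_∈ V H') (sym gx) (from (Ds.vertices _) (inj₂ (x , (x∈ , x≢s , x≢d) , refl)))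

    lab-g : ∀ {x} → x ∈ V RG → lab H' (g x) ≡ lab RG x
    lab-g {x} x∈ with view x
    ... | at-src refl gx = trans (cong (lab H') gx) (trans (Ds.old-lab _ a∈) (trans Ds.a-lab (sym src-lab)))
    ... | at-dst _ refl gx = trans (cong (lab H') gx) (trans (Ds.old-lab _ b∈) (trans Ds.b-lab (sym dst-lab)))
    ... | interior x≢s x≢d gx = trans (cong (lab H') gx) (Ds.new-lab x (x∈ , x≢s , x≢d))

    g-injective : ∀ {x y} → x ∈ V RG → y ∈ V RG → g x ≡ g y → x ≡ y
    g-injective {x} {y} x∈ y∈ gx≡gy with view x | view y
    ... | at-src x≡s _ | at-src y≡s _ = trans x≡s (sym y≡s)
    ... | at-src _ ga | at-dst _ _ gb = ⊥-elim (a≢b (trans (sym ga) (trans gx≡gy gb)))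
    ... | at-src _ ga | interior y≢s y≢d gf =
      ⊥-elim (fresh∉ (y∈ , y≢s , y≢d) (subst (_∈ V H) (trans (sym ga) (trans gx≡gy gf)) a∈))
    ... | at-dst _ _ gb | at-src _ ga = ⊥-elim (a≢b (trans (sym ga) (trans (sym gx≡gy) gb)))
    ... | at-dst _ x≡d _ | at-dst _ y≡d _ = trans x≡d (sym y≡d)
    ... | at-dst _ _ gb | interior y≢s y≢d gf =
      ⊥-elim (fresh∉ (y∈ , y≢s , y≢d) (subst (_∈ V H) (trans (sym gb) (trans gx≡gy gf)) b∈))
    ... | interior x≢s x≢d gf | at-src _ ga =
      ⊥-elim (fresh∉ (x∈ , x≢s , x≢d) (subst (_∈ V H) (trans (sym ga) (trans (sym gx≡gy) gf)) a∈))
    ... | interior x≢s x≢d gf | at-dst _ _ gb =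
      ⊥-elim (fresh∉ (x∈ , x≢s , x≢d) (subst (_∈ V H) (trans (sym gb) (trans (sym gx≡gy) gf)) b∈))
    ... | interior x≢s x≢d gx | interior y≢s y≢d gy =
      Ds.fresh-inj x y (x∈ , x≢s , x≢d) (y∈ , y≢s , y≢d) (trans (sym gx) (trans gx≡gy gy))

    g≢old-wire : ∀ {u y} → y ∈ V RG → u ∈ V H → IsWire (lab H u) → u ≢ g y
    g≢old-wire {u} {y} y∈ u∈ wu u≡gy with view y
    ... | at-src _ ga = wire≢a wu (trans u≡gy ga)
    ... | at-dst _ _ gb = wire≢b wu (trans u≡gy gb)
    ... | interior y≢s y≢d gf = fresh∉ (y∈ , y≢s , y≢d) (subst (_∈ V H) (trans u≡gy gf) u∈)

    fresh≡g⇒≡ : ∀ {x y} → Interior r x → y ∈ V RG → Ds.fresh x ≡ g y → x ≡ y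
    fresh≡g⇒≡ {x} {y} ix y∈ fx≡gy with view y
    ... | at-src _ ga = ⊥-elim (fresh∉ ix (subst (_∈ V H) (sym (trans fx≡gy ga)) a∈))
    ... | at-dst _ _ gb = ⊥-elim (fresh∉ ix (subst (_∈ V H) (sym (trans fx≡gy gb)) b∈))
    ... | interior y≢s y≢d gf = Ds.fresh-inj x y ix (y∈ , y≢s , y≢d) (trans fx≡gy gf)

    wf′ : WF H'
    wf′ _ _ _ e with to (Ds.edges _) e
    ... | inj₁ (e₀ , _) = let (a∈ , b∈ , a≢b) = wf _ _ _ e₀ in old∈ a∈ , old∈ b∈ , a≢b
    ... | inj₂ (x , c₀ , y , e₀ , refl) = let (x∈ , y∈ , x≢y) = R-wf x c₀ y e₀ in
      g∈ x∈ , g∈ y∈ , λ eq → x≢y (g-injective x∈ y∈ eq)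

    terminal′ : ∀ u → u ∈ V H' → IsTerminal (lab H' u)
    terminal′ u m with to (Ds.vertices u) m
    ... | inj₁ m₀ = subst IsTerminal (sym (Ds.old-lab u m₀)) (terminal u m₀)
    ... | inj₂ (x , ix , refl) = subst IsTerminal (sym (Ds.new-lab x ix)) (R-terminal x (proj₁ ix))

    node-enc′ : NodeEdgesEncoded H'
    node-enc′ _ _ _ e na nb with to (Ds.edges _) e
    ... | inj₁ (e₀ , _) = let (a∈ , b∈ , _) = wf _ _ _ e₀ in
      node-enc _ _ _ e₀ (subst IsNode (Ds.old-lab _ a∈) na) (subst IsNode (Ds.old-lab _ b∈) nb)
    ... | inj₂ (x , c₀ , y , e₀ , refl) = let (x∈ , y∈ , _) = R-wf x c₀ y e₀ in
      ⊥-elim (R-no-node-edge x c₀ y e₀ (subst IsNode (lab-g x∈) na , subst IsNode (lab-g y∈) nb))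

    incoming-old : ∀ {u a c} → u ∈ V H → IsWire (lab H u) → (a , c , u) ∈ E H' → (a , c , u) ∈ E H
    incoming-old u∈ wu e with to (Ds.edges _) e
    ... | inj₁ (e₀ , _) = e₀
    ... | inj₂ (_ , _ , _ , e₀ , eq) =
      ⊥-elim (g≢old-wire (proj₁ (proj₂ (R-wf _ _ _ e₀))) u∈ wu (proj₂ (proj₂ (,,-injective eq))))

    outgoing-old : ∀ {u b c} → u ∈ V H → IsWire (lab H u) → (u , c , b) ∈ E H' → (u , c , b) ∈ E H
    outgoing-old u∈ wu e with to (Ds.edges _) e
    ... | inj₁ (e₀ , _) = e₀
    ... | inj₂ (_ , _ , _ , e₀ , eq) =
      ⊥-elim (g≢old-wire (proj₁ (R-wf _ _ _ e₀)) u∈ wu (proj₁ (,,-injective eq)))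

    incoming-new : ∀ {x a c} → Interior r x → (a , c , Ds.fresh x) ∈ E H' →
                   ∃[ y ] ((y , c , x) ∈ E RG × a ≡ g y)
    incoming-new ix e with to (Ds.edges _) e
    ... | inj₁ (e₀ , _) = ⊥-elim (fresh∉ ix (proj₁ (proj₂ (wf _ _ _ e₀))))
    ... | inj₂ (y , _ , _ , e₀ , eq) =
      let (a≡ , c≡ , fx≡) = ,,-injective eq
          x≡ = fresh≡g⇒≡ ix (proj₁ (proj₂ (R-wf _ _ _ e₀))) fx≡
      in y , subst₂ (λ c x → (y , c , x) ∈ E RG) (sym c≡) (sym x≡) e₀ , a≡

    outgoing-new : ∀ {x b c} → Interior r x → (Ds.fresh x , c , b) ∈ E H' →
                   ∃[ y ] ((x , c , y) ∈ E RG × b ≡ g y)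
    outgoing-new ix e with to (Ds.edges _) e
    ... | inj₁ (e₀ , _) = ⊥-elim (fresh∉ ix (proj₁ (wf _ _ _ e₀)))
    ... | inj₂ (_ , _ , y , e₀ , eq) =
      let (fx≡ , c≡ , b≡) = ,,-injective eq
          x≡ = fresh≡g⇒≡ ix (proj₁ (R-wf _ _ _ e₀)) fx≡
      in y , subst₂ (λ c x → (x , c , y) ∈ E RG) (sym c≡) (sym x≡) e₀ , b≡

    wire-deg′ : WireDegrees≤1 H'
    wire-deg′ u m wu with to (Ds.vertices u) m
    ... | inj₁ u∈ =
      (λ _ _ _ _ e e' → proj₁ degs _ _ _ _ (incoming-old u∈ wu₀ e) (incoming-old u∈ wu₀ e')) ,
      (λ _ _ _ _ e e' → proj₂ degs _ _ _ _ (outgoing-old u∈ wu₀ e) (outgoing-old u∈ wu₀ e'))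
      where
        wu₀ = subst IsWire (Ds.old-lab u u∈) wu
        degs = wire-deg u u∈ wu₀
    ... | inj₂ (x , ix , refl) = indeg , outdeg
      where
        degs = R-wire-deg x (proj₁ ix) (subst IsWire (Ds.new-lab x ix) wu)
        indeg : InDeg≤1 H' (Ds.fresh x)
        indeg a c a' c' e e' with incoming-new ix e | incoming-new ix e'
        ... | (y , e₀ , refl) | (y' , e₀' , refl) =
          let (y≡y' , c≡c') = proj₁ degs y c y' c' e₀ e₀' in cong g y≡y' , c≡c'
        outdeg : OutDeg≤1 H' (Ds.fresh x)
        outdeg b c b' c' e e' with outgoing-new ix e | outgoing-new ix e'
        ... | (y , e₀ , refl) | (y' , e₀' , refl) =
          let (y≡y' , c≡c') = proj₂ degs y c y' c' e₀ e₀' in cong g y≡y' , c≡c'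

    inv′ : EncodedStringGraph H'
    inv′ = record { wf = wf′ ; terminal = terminal′ ; node-enc = node-enc′ ; wire-deg = wire-deg′ }

    -- The edge a → b joins node-vertices, so removing it cannot create a
    -- boundary wire; the rule's interior has no boundary of its own.
    same-boundary : SameBoundary H H'
    same-boundary = (λ u → mk⇔ (input⁺ u) (input⁻ u)) , (λ u → mk⇔ (output⁺ u) (output⁻ u))
      where
        input⁺ : ∀ u → IsInput H u → IsInput H' u
        input⁺ u (u∈ , wu , no-in) = old∈ u∈ , subst IsWire (sym (Ds.old-lab u u∈)) wu ,
          λ _ _ e → no-in _ _ (incoming-old u∈ wu e)
        output⁺ : ∀ u → IsOutput H u → IsOutput H' u
        output⁺ u (u∈ , wu , no-out) = old∈ u∈ , subst IsWire (sym (Ds.old-lab u u∈)) wu ,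
          λ _ _ e → no-out _ _ (outgoing-old u∈ wu e)
        input⁻ : ∀ u → IsInput H' u → IsInput H u
        input⁻ u (m , wu , no-in) with to (Ds.vertices u) m
        ... | inj₁ u∈ = u∈ , wu₀ , λ _ _ e → no-in _ _ (from (Ds.edges _) (inj₁ (e ,
                wire≢b wu₀ ∘ proj₂ ∘ proj₂ ∘ ,,-injective)))
          where wu₀ = subst IsWire (Ds.old-lab u u∈) wu
        ... | inj₂ (x , ix , refl) = ⊥-elim (R-no-input x (proj₁ ix , subst IsWire (Ds.new-lab x ix) wu ,
                λ y c e₀ → no-in (g y) c (from (Ds.edges _)
                  (inj₂ (y , c , x , e₀ , cong (λ t → (g y , c , t)) (sym (g-interior ix)))))))
        output⁻ : ∀ u → IsOutput H' u → IsOutput H u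
        output⁻ u (m , wu , no-out) with to (Ds.vertices u) m
        ... | inj₁ u∈ = u∈ , wu₀ , λ _ _ e → no-out _ _ (from (Ds.edges _) (inj₁ (e ,
                wire≢a wu₀ ∘ proj₁ ∘ ,,-injective)))
          where wu₀ = subst IsWire (Ds.old-lab u u∈) wu
        ... | inj₂ (x , ix , refl) = ⊥-elim (R-no-output x (proj₁ ix , subst IsWire (Ds.new-lab x ix) wu ,
                λ y c e₀ → no-out (g y) c (from (Ds.edges _)
                  (inj₂ (x , c , y , e₀ , cong (λ t → (t , c , g y)) (sym (g-interior ix)))))))

  decoding-same-boundary : ∀ {T H F} → ValidDecSys T → Star (DecStep T) H F →
    EncodedStringGraph H → EncodedStringGraph F × SameBoundary H F
  decoding-same-boundary valid ε inv = inv , (λ _ → ⇔.refl) , (λ _ → ⇔.refl)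
  decoding-same-boundary valid (ds ◅ rest) inv =
    let module First = DecodingStep valid ds inv
        (invF , ins , outs) = decoding-same-boundary valid rest First.inv′
        (ins₁ , outs₁) = First.same-boundary
    in invF , (λ u → ⇔.trans (ins₁ u) (ins u)) , (λ u → ⇔.trans (outs₁ u) (outs u))

theorem4 : (A : Alphabet) → let open Core A in
    (T : DecodingSystem) (S : NTL) (Ps : List PProd) →
    ValidDecSys T →
    IsBESGProds (map side₁ Ps) → IsBESGProds (map side₂ Ps) →
    IsPattern Ps →
    (seq : List (Name × PProd)) (Hn Hn' F F' : HGraph) →
    Derive Ps side₁ (start S) seq Hn → Derive Ps side₂ (start S) seq Hn' →
    NoNT Hn → NoNT Hn' →
    Decodes T Hn F → Decodes T Hn' F' →
    IsStringGraph F × IsStringGraph F'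
      × (∀ u → IsInput F u ⇔ IsInput F' u)
      × (∀ u → IsOutput F u ⇔ IsOutput F' u)
theorem4 A T S Ps valid besg₁ besg₂ pat _ _ _ _ _ d₁ d₂ no-nt₁ no-nt₂
         (dec₁ , no-enc₁) (dec₂ , no-enc₂) =
  let (inv₁ , inv₂ , ins , outs) = derivations-same-boundary A besg₁ besg₂ pat d₁ d₂
                                     (start-inv A _ S) (start-inv A _ S) ((λ _ → ⇔.refl) , (λ _ → ⇔.refl))
      (F-enc , F-ins , F-outs) = decoding-same-boundary A valid dec₁ (sentential⇒encoded A inv₁ no-nt₁)
      (F'-enc , F'-ins , F'-outs) = decoding-same-boundary A valid dec₂ (sentential⇒encoded A inv₂ no-nt₂)
  in encoded⇒string A F-enc no-enc₁ , encoded⇒string A F'-enc no-enc₂ ,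
     (λ u → ⇔.trans (⇔.sym (F-ins u)) (⇔.trans (ins u) (F'-ins u))) ,
     (λ u → ⇔.trans (⇔.sym (F-outs u)) (⇔.trans (outs u) (F'-outs u)))
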